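{- Let $G$ be a graph of order $n$ with maximum degree $\Delta(G)=2$. Then $\operatorname{th_+^\times}(G)\geq\left\lceil\frac{1}{2}(\operatorname{Z_+}(G)+n)\right\rceil$, and this bound is tight (equality holds for paths $P_n$).
   Context: All graphs are finite and simple. PSD color change rule: given a set $B$ of blue vertices (others white), let $W_1,\dots,W_k$ be the vertex sets of the components of $G-B$; if $u\in B$ and $w\in W_i$ is the only white neighbor of $u$ in $G[W_i\cup B]$, then $u$ can force $w$. For $S\subseteq V(G)$, $S^{[0]}=S$ and $S^{[i]}=S^{[i-1]}\cup\{w\notin S^{[i-1]}: w$ can be forced given blue set $S^{[i-1]}\}$. $S$ is a PSD forcing set if $S^{[i]}=V(G)$ for some $i$; $\operatorname{pt_+}(G;S)$ is the least such $i$ ($\infty$ if none). $\operatorname{Z_+}(G)$ is the minimum size of a PSD forcing set, and $\operatorname{th_+^\times}(G)=\min\{|S|(1+\operatorname{pt_+}(G;S)): S\subseteq V(G),|S|\ge\operatorname{Z_+}(G)\}$. -}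

module Defs where

open import Data.Nat using (ℕ; zero; suc; _+_; _*_; _≤_; _≡ᵇ_)
open import Data.Bool using (Bool; true; false; _∨_; T)
open import Data.Bool.Properties using (∨-comm)
open import Data.Fin using (Fin; toℕ)
open import Data.Fin.Subset using (Subset; _∈_; ∣_∣)
open import Data.Vec using (tabulate)
open import Data.Product using (Σ; _×_; _,_)
open import Data.Sum using (_⊎_)
open import Relation.Nullary using (¬_)
open import Relation.Binary.PropositionalEquality using (_≡_; refl)

record Graph (n : ℕ) : Set where
  field
    adj    : Fin n → Fin n → Bool
    sym    : ∀ u v → adj u v ≡ adj v u
    irrefl : ∀ v → adj v v ≡ false
open Graph public

Adj : ∀ {n} → Graph n → Fin n → Fin n → Set
Adj G u v = T (adj G u v)

deg : ∀ {n} → Graph n → Fin n → ℕ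
deg G v = ∣ tabulate (adj G v) ∣

MaxDegree : ∀ {n} → Graph n → ℕ → Set
MaxDegree G d = (∀ v → deg G v ≤ d) × Σ _ (λ v → deg G v ≡ d)

-- WhiteWalk G B w x : x lies in the same component of G - B as w
-- (a walk from w to x all of whose vertices are white, i.e. not in B).
data WhiteWalk {n} (G : Graph n) (B : Fin n → Set) : Fin n → Fin n → Set where
  here : ∀ {w} → ¬ B w → WhiteWalk G B w w
  step : ∀ {w y x} → ¬ B w → Adj G w y → WhiteWalk G B y x → WhiteWalk G B w x

-- PSD color change rule: u ∈ B can force w, where w is white and is the only
-- white neighbour of u in G[W_i ∪ B], W_i the component of G - B containing w.
CanForce : ∀ {n} → Graph n → (Fin n → Set) → Fin n → Fin n → Set
CanForce G B u w =
  B u × ¬ B w × Adj G u w ×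
  (∀ x → ¬ B x → Adj G u x → WhiteWalk G B w x → x ≡ w)

Blue : ∀ {n} → Graph n → Subset n → ℕ → Fin n → Set
Blue G S zero v = v ∈ S
Blue G S (suc i) v = Blue G S i v ⊎ Σ _ (λ u → CanForce G (Blue G S i) u v)

AllBlueAt : ∀ {n} → Graph n → Subset n → ℕ → Set
AllBlueAt G S i = ∀ v → Blue G S i v

PSDForcingSet : ∀ {n} → Graph n → Subset n → Set
PSDForcingSet G S = Σ ℕ (λ i → AllBlueAt G S i)

IsPT : ∀ {n} → Graph n → Subset n → ℕ → Set
IsPT G S k = AllBlueAt G S k × (∀ j → AllBlueAt G S j → k ≤ j)

IsZplus : ∀ {n} → Graph n → ℕ → Set
IsZplus G z =
  Σ _ (λ S → ∣ S ∣ ≡ z × PSDForcingSet G S) ×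
  (∀ S → PSDForcingSet G S → z ≤ ∣ S ∣)

-- th₊^×(G) = t, given Z₊(G) = z. Sets with pt₊ = ∞ contribute ∞ to the
-- minimum, so only sets with finite propagation time are considered.
IsThPlusX : ∀ {n} → Graph n → ℕ → Set
IsThPlusX G t =
  Σ ℕ λ z → IsZplus G z ×
    (Σ _ (λ S → Σ ℕ λ k → z ≤ ∣ S ∣ × IsPT G S k × t ≡ ∣ S ∣ * suc k) ×
     (∀ S k → z ≤ ∣ S ∣ → IsPT G S k → t ≤ ∣ S ∣ * suc k))

private
  suc≡ᵇ : ∀ m → (suc m ≡ᵇ m) ≡ false
  suc≡ᵇ zero = refl
  suc≡ᵇ (suc m) = suc≡ᵇ m

pathAdj : ∀ {n} → Fin n → Fin n → Bool
pathAdj u v = (suc (toℕ u) ≡ᵇ toℕ v) ∨ (suc (toℕ v) ≡ᵇ toℕ u)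

Path : (n : ℕ) → Graph n
Path n = record
  { adj = pathAdj
  ; sym = λ u v → ∨-comm (suc (toℕ u) ≡ᵇ toℕ v) (suc (toℕ v) ≡ᵇ toℕ u)
  ; irrefl = λ v → irr (toℕ v)
  }
  where
  irr : ∀ m → ((suc m ≡ᵇ m) ∨ (suc m ≡ᵇ m)) ≡ false
  irr m with suc m ≡ᵇ m | suc≡ᵇ m
  ... | false | _ = refl

-- After i rounds every blue vertex lies within distance i of S, since a forced vertex is
-- adjacent to a vertex that was blue one round earlier. If Δ(G) ≤ 2, a ball of radius i has at
-- most 2i + 1 vertices: a vertex at distance j ≥ 1 from the centre has a neighbour at distance
-- j - 1, hence at most one neighbour at distance j + 1, so the spheres never grow beyond the two
-- neighbours of the centre. Thus n ≤ |S| (1 + 2 pt₊(G;S)), and with Z₊(G) ≤ |S| this gives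
-- Z₊(G) + n ≤ 2 |S| (1 + pt₊(G;S)). On Pₙ the middle vertex forces outwards in both directions
-- and colours the path in ⌊n/2⌋ rounds, attaining the bound.

module Submission where

open import Data.Nat using (ℕ; zero; suc; _+_; _*_; _≤_; _<_; z≤n; s≤s; _≡ᵇ_; ⌈_/2⌉; ⌊_/2⌋)
open import Data.Nat.Properties
  using (≤-refl; ≤-reflexive; ≤-trans; ≤-pred; ≤-antisym; <⇒≤; ≤-<-trans; ≤∧≢⇒<; ≰⇒>; 1+n≰n; _≤?_;
         n≤1+n; m≤m+n; m≤n+m; +-mono-≤; +-monoʳ-≤; +-comm; +-suc; +-identityʳ; *-identityˡ;
         ≡ᵇ⇒≡; ≡⇒≡ᵇ; n≡⌈n+n/2⌉; ⌈n/2⌉-mono; ⌊n/2⌋-mono; ⌊n/2⌋<n; module ≤-Reasoning)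
  renaming (suc-injective to ℕ-suc-injective)
open import Data.Nat.Tactic.RingSolver using (solve-∀)
open import Data.Bool using (Bool; T)
open import Data.Bool.Properties using (T-≡; T-∨)
open import Data.Fin using (Fin; zero; suc; toℕ; fromℕ<)
open import Data.Fin.Properties
  using (_≟_; any?; 0≢1+n; suc-injective; toℕ-injective; toℕ-fromℕ<; toℕ<n)
open import Data.Fin.Subset
  using (Subset; inside; outside; _∈_; _∉_; _⊆_; _∪_; _─_; _-_; ∣_∣; ⁅_⁆; ⊤)
  renaming (⊥ to ∅)
open import Data.Fin.Subset.Properties
  using (_∈?_; x∈⁅x⁆; x∈⁅y⁆⇒x≡y; ∣⁅x⁆∣≡1; ∣⊤∣≡n; ∣⊥∣≡0; x∈p∪q⁺; x∈p∪q⁻; p─q⊆p; x∈p∧x∉q⇒x∈p─q;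
         x∈p∧x≢y⇒x∈p-y; x∈p⇒∣p-x∣<∣p∣; ∣p─q∣≤∣p∣; p⊆q⇒∣p∣≤∣q∣)
open import Data.Vec using ([]; _∷_; here; there; tabulate)
open import Data.Vec.Properties using (lookup∘tabulate; lookup⇒[]=; []=⇒lookup)
open import Data.Product using (Σ; ∃; _×_; _,_; proj₁; proj₂)
open import Data.Sum using (_⊎_; inj₁; inj₂; [_,_]′)
import Data.Sum as Sum
open import Data.Empty using (⊥; ⊥-elim)
open import Function using (_∘_)
open import Function.Bundles using (Equivalence)
open import Relation.Nullary using (¬_; yes; no; _×-dec_)
open import Relation.Nullary.Decidable using (isYes; T?; toWitness; fromWitness)
open import Relation.Binary.PropositionalEquality as ≡ using (_≡_; _≢_; refl; cong; subst)
open import Defs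

open Equivalence using (to; from)

∈-tabulate⁺ : ∀ {n} {f : Fin n → Bool} {x} → T (f x) → x ∈ tabulate f
∈-tabulate⁺ {f = f} {x} fx = lookup⇒[]= x _ (≡.trans (lookup∘tabulate f x) (to T-≡ fx))

∈-tabulate⁻ : ∀ {n} {f : Fin n → Bool} {x} → x ∈ tabulate f → T (f x)
∈-tabulate⁻ {f = f} {x} x∈ = from T-≡ (≡.trans (≡.sym (lookup∘tabulate f x)) ([]=⇒lookup x∈))

x∈p─q⇒x∉q : ∀ {n} {x : Fin n} (p q : Subset n) → x ∈ p ─ q → x ∉ q
x∈p─q⇒x∉q (_ ∷ p) (_ ∷ q) (there x∈p─q) (there x∈q) = x∈p─q⇒x∉q p q x∈p─q x∈q

∣p∪q∣≡∣p∣+∣q─p∣ : ∀ {n} (p q : Subset n) → ∣ p ∪ q ∣ ≡ ∣ p ∣ + ∣ q ─ p ∣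
∣p∪q∣≡∣p∣+∣q─p∣ [] [] = refl
∣p∪q∣≡∣p∣+∣q─p∣ (inside ∷ p) (_ ∷ q) = cong suc (∣p∪q∣≡∣p∣+∣q─p∣ p q)
∣p∪q∣≡∣p∣+∣q─p∣ (outside ∷ p) (inside ∷ q) =
  ≡.trans (cong suc (∣p∪q∣≡∣p∣+∣q─p∣ p q)) (≡.sym (+-suc ∣ p ∣ ∣ q ─ p ∣))
∣p∪q∣≡∣p∣+∣q─p∣ (outside ∷ p) (outside ∷ q) = ∣p∪q∣≡∣p∣+∣q─p∣ p q

∣p∪q∣≤∣p∣+∣q∣ : ∀ {n} (p q : Subset n) → ∣ p ∪ q ∣ ≤ ∣ p ∣ + ∣ q ∣
∣p∪q∣≤∣p∣+∣q∣ p q = ≤-trans (≤-reflexive (∣p∪q∣≡∣p∣+∣q─p∣ p q)) (+-monoʳ-≤ ∣ p ∣ (∣p─q∣≤∣p∣ q p))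

record _↪_ {m n} (p : Subset m) (q : Subset n) : Set where
  field
    embed           : ∀ {x} → x ∈ p → Fin n
    embed-∈         : ∀ {x} (x∈p : x ∈ p) → embed x∈p ∈ q
    embed-injective : ∀ {x y} (x∈p : x ∈ p) (y∈p : y ∈ p) → embed x∈p ≡ embed y∈p → x ≡ y
open _↪_

↪-tail : ∀ {m n s} {p : Subset m} {q q′ : Subset n} (e : (s ∷ p) ↪ q) →
         (∀ {x} (x∈p : x ∈ p) → embed e (there x∈p) ∈ q′) → p ↪ q′
↪-tail e tail-∈ = record
  { embed = embed e ∘ there
  ; embed-∈ = tail-∈
  ; embed-injective = λ x∈p y∈p eq → suc-injective (embed-injective e (there x∈p) (there y∈p) eq)
  }

↪⇒∣p∣≤∣q∣ : ∀ {m n} {p : Subset m} {q : Subset n} → p ↪ q → ∣ p ∣ ≤ ∣ q ∣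
↪⇒∣p∣≤∣q∣ {p = []} _ = z≤n
↪⇒∣p∣≤∣q∣ {p = outside ∷ p} e = ↪⇒∣p∣≤∣q∣ (↪-tail e (embed-∈ e ∘ there))
↪⇒∣p∣≤∣q∣ {p = inside ∷ p} e =
  ≤-trans (s≤s (↪⇒∣p∣≤∣q∣ (↪-tail e tail∈q-head))) (x∈p⇒∣p-x∣<∣p∣ (embed-∈ e here))
  where
  tail∈q-head : ∀ {x} (x∈p : x ∈ p) → embed e (there x∈p) ∈ _ - embed e here
  tail∈q-head x∈p = x∈p∧x≢y⇒x∈p-y (embed-∈ e (there x∈p))
                      (λ eq → 0≢1+n (embed-injective e here (there x∈p) (≡.sym eq)))

∣p∣≤1 : ∀ {n} {p : Subset n} → (∀ {x y} → x ∈ p → y ∈ p → x ≡ y) → ∣ p ∣ ≤ 1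
∣p∣≤1 unique = ↪⇒∣p∣≤∣q∣ {q = ⊤ {1}} record
  { embed = λ _ → zero ; embed-∈ = λ _ → here ; embed-injective = λ x∈p y∈p _ → unique x∈p y∈p }

3≤∣p∣ : ∀ {n} {p : Subset n} {a b c} → a ∈ p → b ∈ p → c ∈ p → a ≢ b → a ≢ c → b ≢ c → 3 ≤ ∣ p ∣
3≤∣p∣ a∈p b∈p c∈p a≢b a≢c b≢c = ≤-trans (s≤s 2≤∣p-a∣) (x∈p⇒∣p-x∣<∣p∣ a∈p)
  where
  b∈p-a = x∈p∧x≢y⇒x∈p-y b∈p (a≢b ∘ ≡.sym)
  c∈p-a-b = x∈p∧x≢y⇒x∈p-y (x∈p∧x≢y⇒x∈p-y c∈p (a≢c ∘ ≡.sym)) (b≢c ∘ ≡.sym)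
  1≤∣p-a-b∣ = ≤-trans (s≤s z≤n) (x∈p⇒∣p-x∣<∣p∣ c∈p-a-b)
  2≤∣p-a∣ = ≤-trans (s≤s 1≤∣p-a-b∣) (x∈p⇒∣p-x∣<∣p∣ b∈p-a)

⋃[_]_ : ∀ {m n} → Subset m → (Fin m → Subset n) → Subset n
⋃[ [] ] F = ∅
⋃[ inside ∷ S ] F = F zero ∪ ⋃[ S ] (F ∘ suc)
⋃[ outside ∷ S ] F = ⋃[ S ] (F ∘ suc)

∈⋃[]⁺ : ∀ {m n} {S : Subset m} {F : Fin m → Subset n} {s x} → s ∈ S → x ∈ F s → x ∈ ⋃[ S ] F
∈⋃[]⁺ {S = inside ∷ S} here x∈Fs = x∈p∪q⁺ (inj₁ x∈Fs)
∈⋃[]⁺ {S = inside ∷ S} (there s∈S) x∈Fs = x∈p∪q⁺ (inj₂ (∈⋃[]⁺ s∈S x∈Fs))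
∈⋃[]⁺ {S = outside ∷ S} (there s∈S) x∈Fs = ∈⋃[]⁺ s∈S x∈Fs

∣⋃[]∣≤ : ∀ {m n} {S : Subset m} {F : Fin m → Subset n} {b} →
         (∀ {s} → s ∈ S → ∣ F s ∣ ≤ b) → ∣ ⋃[ S ] F ∣ ≤ ∣ S ∣ * b
∣⋃[]∣≤ {n = n} {S = []} _ = ≤-reflexive (∣⊥∣≡0 n)
∣⋃[]∣≤ {S = inside ∷ S} {F} bound =
  ≤-trans (∣p∪q∣≤∣p∣+∣q∣ (F zero) _) (+-mono-≤ (bound here) (∣⋃[]∣≤ (bound ∘ there)))
∣⋃[]∣≤ {S = outside ∷ S} bound = ∣⋃[]∣≤ (bound ∘ there)

DegreeAtMost : ∀ {n} → Graph n → ℕ → Set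
DegreeAtMost G d = ∀ v → deg G v ≤ d

WhiteWalk-head : ∀ {n} {G : Graph n} {B w x} → WhiteWalk G B w x → ¬ B w
WhiteWalk-head (here w-white) = w-white
WhiteWalk-head (step w-white _ _) = w-white

module _ {n} (G : Graph n) where

  adj-sym : ∀ {u v} → Adj G u v → Adj G v u
  adj-sym {u} {v} = subst T (Graph.sym G u v)

  no-three-neighbours : DegreeAtMost G 2 → ∀ {v a b c} → Adj G v a → Adj G v b → Adj G v c →
                        a ≢ b → a ≢ c → b ≢ c → ⊥
  no-three-neighbours deg≤2 {v} v~a v~b v~c a≢b a≢c b≢c =
    1+n≰n (≤-trans (3≤∣p∣ (∈-tabulate⁺ v~a) (∈-tabulate⁺ v~b) (∈-tabulate⁺ v~c) a≢b a≢c b≢c)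
                   (deg≤2 v))

  neighbourhood : Subset n → Subset n
  neighbourhood p = tabulate λ v → isYes (any? λ u → u ∈? p ×-dec T? (adj G u v))

  ∈neighbourhood⁺ : ∀ {p u v} → u ∈ p → Adj G u v → v ∈ neighbourhood p
  ∈neighbourhood⁺ {u = u} u∈p u~v = ∈-tabulate⁺ (fromWitness (u , u∈p , u~v))

  ∈neighbourhood⁻ : ∀ {p v} → v ∈ neighbourhood p → ∃ λ u → u ∈ p × Adj G u v
  ∈neighbourhood⁻ v∈ = toWitness (∈-tabulate⁻ v∈)

  ball : Fin n → ℕ → Subset n
  ball s zero = ⁅ s ⁆
  ball s (suc i) = ball s i ∪ neighbourhood (ball s i)

  sphere : Fin n → ℕ → Subset n
  sphere s i = neighbourhood (ball s i) ─ ball s i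

  ball⊆ball-suc : ∀ {s i} → ball s i ⊆ ball s (suc i)
  ball⊆ball-suc x∈ = x∈p∪q⁺ (inj₁ x∈)

  ∣ball-suc∣≡ : ∀ s i → ∣ ball s (suc i) ∣ ≡ ∣ ball s i ∣ + ∣ sphere s i ∣
  ∣ball-suc∣≡ s i = ∣p∪q∣≡∣p∣+∣q─p∣ (ball s i) (neighbourhood (ball s i))

  module _ (deg≤2 : DegreeAtMost G 2) where

    sphere-suc↪sphere : ∀ s i → sphere s (suc i) ↪ sphere s i
    sphere-suc↪sphere s i = record
      { embed = parent ; embed-∈ = parent∈sphere ; embed-injective = parent-injective }
      where
      outside-ball : ∀ {x} → x ∈ sphere s (suc i) → x ∉ ball s (suc i)
      outside-ball = x∈p─q⇒x∉q (neighbourhood (ball s (suc i))) (ball s (suc i))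

      parent-spec : ∀ {x} → x ∈ sphere s (suc i) → ∃ λ u → u ∈ ball s (suc i) × Adj G u x
      parent-spec x∈ = ∈neighbourhood⁻ (p─q⊆p _ _ x∈)

      parent : ∀ {x} → x ∈ sphere s (suc i) → Fin n
      parent x∈ = proj₁ (parent-spec x∈)

      parent∈sphere : ∀ {x} (x∈ : x ∈ sphere s (suc i)) → parent x∈ ∈ sphere s i
      parent∈sphere x∈ with parent-spec x∈
      ... | u , u∈ , u~x =
        [ ⊥-elim ∘ u∉ball , (λ u∈N → x∈p∧x∉q⇒x∈p─q u∈N u∉ball) ]′ (x∈p∪q⁻ (ball s i) _ u∈)
        where
        u∉ball : u ∉ ball s i
        u∉ball u∈ball = outside-ball x∈ (x∈p∪q⁺ (inj₂ (∈neighbourhood⁺ u∈ball u~x)))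

      parent-injective : ∀ {x y} (x∈ : x ∈ sphere s (suc i)) (y∈ : y ∈ sphere s (suc i)) →
                         parent x∈ ≡ parent y∈ → x ≡ y
      parent-injective {x} {y} x∈ y∈ same with x ≟ y
      ... | yes x≡y = x≡y
      ... | no x≢y = ⊥-elim (no-three-neighbours deg≤2 u~x u~y u~w x≢y (≢w x∈) (≢w y∈))
        where
        u~x = proj₂ (proj₂ (parent-spec x∈))
        u~y = subst (λ u → Adj G u y) (≡.sym same) (proj₂ (proj₂ (parent-spec y∈)))
        w-spec = ∈neighbourhood⁻ (p─q⊆p _ _ (parent∈sphere x∈))
        u~w = adj-sym (proj₂ (proj₂ w-spec))
        ≢w : ∀ {z} → z ∈ sphere s (suc i) → z ≢ proj₁ w-spec
        ≢w z∈ refl = outside-ball z∈ (ball⊆ball-suc {s} {i} (proj₁ (proj₂ w-spec)))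

    ∣sphere∣≤2 : ∀ s i → ∣ sphere s i ∣ ≤ 2
    ∣sphere∣≤2 s zero = ≤-trans (p⊆q⇒∣p∣≤∣q∣ sphere⊆neighbours) (deg≤2 s)
      where
      sphere⊆neighbours : sphere s zero ⊆ tabulate (adj G s)
      sphere⊆neighbours x∈ with ∈neighbourhood⁻ (p─q⊆p _ _ x∈)
      ... | u , u∈⁅s⁆ , u~x = ∈-tabulate⁺ (subst (λ u → Adj G u _) (x∈⁅y⁆⇒x≡y s u∈⁅s⁆) u~x)
    ∣sphere∣≤2 s (suc i) = ≤-trans (↪⇒∣p∣≤∣q∣ (sphere-suc↪sphere s i)) (∣sphere∣≤2 s i)

    ∣ball∣≤ : ∀ s i → ∣ ball s i ∣ ≤ suc (i + i)
    ∣ball∣≤ s zero = ≤-reflexive (∣⁅x⁆∣≡1 s)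
    ∣ball∣≤ s (suc i) = begin
      ∣ ball s (suc i) ∣            ≡⟨ ∣ball-suc∣≡ s i ⟩
      ∣ ball s i ∣ + ∣ sphere s i ∣  ≤⟨ +-mono-≤ (∣ball∣≤ s i) (∣sphere∣≤2 s i) ⟩
      suc (i + i) + 2               ≡⟨ +-comm (suc (i + i)) 2 ⟩
      suc (suc (suc (i + i)))       ≡⟨ cong (2 +_) (+-suc i i) ⟨
      suc (suc i + suc i)           ∎
      where open ≤-Reasoning

  Blue⇒∈ball : ∀ {S} i {v} → Blue G S i v → ∃ λ s → s ∈ S × v ∈ ball s i
  Blue⇒∈ball zero {v} v∈S = v , v∈S , x∈⁅x⁆ v
  Blue⇒∈ball (suc i) (inj₁ v-blue) with Blue⇒∈ball i v-blue
  ... | s , s∈S , v∈ball = s , s∈S , ball⊆ball-suc {s} {i} v∈ball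
  Blue⇒∈ball (suc i) (inj₂ (u , u-blue , _ , u~v , _)) with Blue⇒∈ball i u-blue
  ... | s , s∈S , u∈ball = s , s∈S , x∈p∪q⁺ (inj₂ (∈neighbourhood⁺ u∈ball u~v))

  n≤∣S∣*[1+2pt] : DegreeAtMost G 2 → ∀ {S k} → AllBlueAt G S k → n ≤ ∣ S ∣ * suc (k + k)
  n≤∣S∣*[1+2pt] deg≤2 {S} {k} all-blue = begin
    n                              ≡⟨ ∣⊤∣≡n n ⟨
    ∣ ⊤ {n} ∣                      ≤⟨ p⊆q⇒∣p∣≤∣q∣ covered ⟩
    ∣ ⋃[ S ] (λ s → ball s k) ∣    ≤⟨ ∣⋃[]∣≤ {S = S} (λ {s} _ → ∣ball∣≤ deg≤2 s k) ⟩
    ∣ S ∣ * suc (k + k)            ∎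
    where
    open ≤-Reasoning
    covered : ⊤ ⊆ ⋃[ S ] (λ s → ball s k)
    covered {v} _ with Blue⇒∈ball k (all-blue v)
    ... | s , s∈S , v∈ball = ∈⋃[]⁺ s∈S v∈ball

  th⁺-lower-bound : DegreeAtMost G 2 → ∀ {z S k} → z ≤ ∣ S ∣ → AllBlueAt G S k →
                    ⌈ (z + n) /2⌉ ≤ ∣ S ∣ * suc k
  th⁺-lower-bound deg≤2 {z} {S} {k} z≤∣S∣ all-blue = begin
    ⌈ (z + n) /2⌉                        ≤⟨ ⌈n/2⌉-mono (+-mono-≤ z≤∣S∣ n≤∣S∣*[1+2k]) ⟩
    ⌈ (∣ S ∣ + ∣ S ∣ * suc (k + k)) /2⌉   ≡⟨ cong ⌈_/2⌉ (double ∣ S ∣ k) ⟩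
    ⌈ (∣ S ∣ * suc k + ∣ S ∣ * suc k) /2⌉ ≡⟨ n≡⌈n+n/2⌉ (∣ S ∣ * suc k) ⟨
    ∣ S ∣ * suc k                        ∎
    where
    open ≤-Reasoning
    n≤∣S∣*[1+2k] = n≤∣S∣*[1+2pt] deg≤2 all-blue
    double : ∀ s k → s + s * suc (k + k) ≡ s * suc k + s * suc k
    double = solve-∀

  Zplus-minimal : ∀ {z z′} → IsZplus G z → IsZplus G z′ → z ≤ z′
  Zplus-minimal (_ , minimal) ((S , ∣S∣≡z′ , forcing) , _) = subst (_ ≤_) ∣S∣≡z′ (minimal S forcing)

  Zplus-singleton : ∀ (v : Fin n) → PSDForcingSet G ⁅ v ⁆ → IsZplus G 1
  Zplus-singleton v forcing = (⁅ v ⁆ , ∣⁅x⁆∣≡1 v , forcing) , nonempty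
    where
    nonempty : ∀ S → PSDForcingSet G S → 1 ≤ ∣ S ∣
    nonempty S (i , all-blue) with Blue⇒∈ball i (all-blue v)
    ... | s , s∈S , _ = ≤-trans (s≤s z≤n) (x∈p⇒∣p-x∣<∣p∣ s∈S)

th⁺×-lower-bound : ∀ {n} (G : Graph n) → MaxDegree G 2 →
                   ∀ {z t} → IsZplus G z → IsThPlusX G t → ⌈ (z + n) /2⌉ ≤ t
th⁺×-lower-bound G (deg≤2 , _) zp (z′ , zp′ , (S , k , z′≤∣S∣ , (all-blue , _) , t≡) , _) =
  subst (_ ≤_) (≡.sym t≡)
    (th⁺-lower-bound G deg≤2 (≤-trans (Zplus-minimal G zp zp′) z′≤∣S∣) all-blue)

module _ {n : ℕ} where

  path-adj⁻ : ∀ {u v : Fin n} → Adj (Path n) u v → suc (toℕ u) ≡ toℕ v ⊎ suc (toℕ v) ≡ toℕ u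
  path-adj⁻ {u = u} {v = v} u~v =
    Sum.map (≡ᵇ⇒≡ _ _) (≡ᵇ⇒≡ _ _) (to (T-∨ {suc (toℕ u) ≡ᵇ toℕ v}) u~v)

  path-adj⁺ : ∀ {u v : Fin n} → suc (toℕ u) ≡ toℕ v ⊎ suc (toℕ v) ≡ toℕ u → Adj (Path n) u v
  path-adj⁺ {u} {v} e = from (T-∨ {suc (toℕ u) ≡ᵇ toℕ v}) (Sum.map (≡⇒≡ᵇ _ _) (≡⇒≡ᵇ _ _) e)

  Path-degree≤2 : DegreeAtMost (Path n) 2
  Path-degree≤2 v = begin
    ∣ tabulate (adj (Path n) v) ∣    ≤⟨ p⊆q⇒∣p∣≤∣q∣ split ⟩
    ∣ successor ∪ predecessor ∣      ≤⟨ ∣p∪q∣≤∣p∣+∣q∣ successor predecessor ⟩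
    ∣ successor ∣ + ∣ predecessor ∣  ≤⟨ +-mono-≤ (∣p∣≤1 successor-unique)
                                                   (∣p∣≤1 predecessor-unique) ⟩
    2                                ∎
    where
    open ≤-Reasoning
    successor predecessor : Subset n
    successor = tabulate λ x → suc (toℕ v) ≡ᵇ toℕ x
    predecessor = tabulate λ x → suc (toℕ x) ≡ᵇ toℕ v
    split : tabulate (adj (Path n) v) ⊆ successor ∪ predecessor
    split x∈ = x∈p∪q⁺ (Sum.map ∈-tabulate⁺ ∈-tabulate⁺ (to T-∨ (∈-tabulate⁻ x∈)))
    successor-unique : ∀ {x y} → x ∈ successor → y ∈ successor → x ≡ y
    successor-unique x∈ y∈ =
      toℕ-injective
        (≡.trans (≡.sym (≡ᵇ⇒≡ (suc (toℕ v)) _ (∈-tabulate⁻ x∈)))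
                 (≡ᵇ⇒≡ (suc (toℕ v)) _ (∈-tabulate⁻ y∈)))
    predecessor-unique : ∀ {x y} → x ∈ predecessor → y ∈ predecessor → x ≡ y
    predecessor-unique x∈ y∈ =
      toℕ-injective (ℕ-suc-injective
        (≡.trans (≡ᵇ⇒≡ _ (toℕ v) (∈-tabulate⁻ x∈)) (≡.sym (≡ᵇ⇒≡ _ (toℕ v) (∈-tabulate⁻ y∈)))))

module SingleSourceOnPath {n : ℕ} (c : ℕ) (c<n : c < n) where

  source : Fin n
  source = fromℕ< c<n

  S : Subset n
  S = ⁅ source ⁆

  toℕ-source : toℕ source ≡ c
  toℕ-source = toℕ-fromℕ< c<n

  ≡source : ∀ {v} → toℕ v ≡ c → v ≡ source
  ≡source v≡c = toℕ-injective (≡.trans v≡c (≡.sym toℕ-source))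

  Within : ℕ → Fin n → Set
  Within i v = toℕ v ≤ c + i × c ≤ toℕ v + i

  source-within : ∀ i → Within i source
  source-within i rewrite toℕ-source = m≤m+n c i , m≤m+n c i

  Within-suc : ∀ {i v} → Within i v → Within (suc i) v
  Within-suc {i} {v} (v≤ , c≤) =
    ≤-trans v≤ (+-monoʳ-≤ c (n≤1+n i)) , ≤-trans c≤ (+-monoʳ-≤ (toℕ v) (n≤1+n i))

  Within-neighbour : ∀ {i u v} → Within i u → Adj (Path n) u v → Within (suc i) v
  Within-neighbour {i} {u} {v} (u≤ , c≤) u~v with path-adj⁻ {u = u} {v = v} u~v
  ... | inj₁ u+1≡v rewrite ≡.sym u+1≡v | +-suc c i =
    s≤s u≤ , ≤-trans c≤ (+-mono-≤ (n≤1+n (toℕ u)) (n≤1+n i))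
  ... | inj₂ v+1≡u rewrite ≡.sym v+1≡u | +-suc (toℕ v) i =
    ≤-trans (n≤1+n (toℕ v)) (≤-trans u≤ (+-monoʳ-≤ c (n≤1+n i))) , c≤

  Blue⇒Within : ∀ i {v} → Blue (Path n) S i v → Within i v
  Blue⇒Within zero v∈S rewrite x∈⁅y⁆⇒x≡y source v∈S = source-within 0
  Blue⇒Within (suc i) (inj₁ v-blue) = Within-suc (Blue⇒Within i v-blue)
  Blue⇒Within (suc i) (inj₂ (u , u-blue , _ , u~v , _)) =
    Within-neighbour (Blue⇒Within i u-blue) u~v

  module _ {B : Fin n → Set} (source-blue : B source) where

    white-walk-stays-right : ∀ {w x} → WhiteWalk (Path n) B w x → c < toℕ w → c < toℕ x
    white-walk-stays-right (here _) c<w = c<w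
    white-walk-stays-right (step {w} {y} _ w~y walk) c<w with path-adj⁻ {u = w} {v = y} w~y
    ... | inj₁ w+1≡y =
      white-walk-stays-right walk (≤-trans c<w (≤-trans (n≤1+n _) (≤-reflexive w+1≡y)))
    ... | inj₂ y+1≡w =
      white-walk-stays-right walk (≤∧≢⇒< (≤-pred (subst (suc c ≤_) (≡.sym y+1≡w) c<w)) c≢y)
      where
      c≢y : c ≢ toℕ y
      c≢y c≡y = WhiteWalk-head walk (subst B (≡.sym (≡source (≡.sym c≡y))) source-blue)

    white-walk-stays-left : ∀ {w x} → WhiteWalk (Path n) B w x → toℕ w < c → toℕ x < c
    white-walk-stays-left (here _) w<c = w<c
    white-walk-stays-left (step {w} {y} _ w~y walk) w<c with path-adj⁻ {u = w} {v = y} w~y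
    ... | inj₂ y+1≡w =
      white-walk-stays-left walk (≤-trans (≤-reflexive y+1≡w) (≤-trans (n≤1+n _) w<c))
    ... | inj₁ w+1≡y =
      white-walk-stays-left walk (≤∧≢⇒< (subst (_≤ c) w+1≡y w<c) y≢c)
      where
      y≢c : toℕ y ≢ c
      y≢c y≡c = WhiteWalk-head walk (subst B (≡.sym (≡source y≡c)) source-blue)

  Covered : ℕ → Set
  Covered i = ∀ {w} → Within i w → Blue (Path n) S i w

  -- A white walk from c + i + 1 cannot cross the blue source, so the other neighbour of c + i,
  -- if reachable, lies in the interval and is already blue.
  force-rightwards : ∀ {i v} → Covered i → toℕ v ≡ suc (c + i) →
                     ∃ λ u → CanForce (Path n) (Blue (Path n) S i) u v
  force-rightwards {i} {v} covered v≡ = u , covered u-within , v-white , u~v , unique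
    where
    c+i<n : c + i < n
    c+i<n = subst (_≤ n) v≡ (<⇒≤ (toℕ<n v))
    u = fromℕ< c+i<n
    toℕ-u : toℕ u ≡ c + i
    toℕ-u = toℕ-fromℕ< c+i<n
    u-within : Within i u
    u-within rewrite toℕ-u = ≤-refl , ≤-trans (m≤m+n c i) (m≤m+n (c + i) i)
    v-white : ¬ Blue (Path n) S i v
    v-white v-blue = 1+n≰n (subst (_≤ c + i) v≡ (proj₁ (Blue⇒Within i v-blue)))
    u~v : Adj (Path n) u v
    u~v = path-adj⁺ (inj₁ (≡.trans (cong suc toℕ-u) (≡.sym v≡)))
    unique : ∀ x → ¬ Blue (Path n) S i x → Adj (Path n) u x →
             WhiteWalk (Path n) (Blue (Path n) S i) v x → x ≡ v
    unique x x-white u~x walk with path-adj⁻ {u = u} {v = x} u~x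
    ... | inj₁ u+1≡x = toℕ-injective (≡.trans (≡.sym u+1≡x) (≡.trans (cong suc toℕ-u) (≡.sym v≡)))
    ... | inj₂ x+1≡u = ⊥-elim (x-white (covered (x≤c+i , ≤-trans (<⇒≤ c<x) (m≤m+n (toℕ x) i))))
      where
      x≤c+i : toℕ x ≤ c + i
      x≤c+i = ≤-trans (n≤1+n (toℕ x)) (≤-reflexive (≡.trans x+1≡u toℕ-u))
      c<x : c < toℕ x
      c<x = white-walk-stays-right (covered (source-within i)) walk
              (subst (c <_) (≡.sym v≡) (s≤s (m≤m+n c i)))

  force-leftwards : ∀ {i v} → Covered i → toℕ v + suc i ≡ c →
                    ∃ λ u → CanForce (Path n) (Blue (Path n) S i) u v
  force-leftwards {i} {v} covered v+1+i≡c = u , covered u-within , v-white , u~v , unique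
    where
    c≡ : c ≡ suc (toℕ v + i)
    c≡ = ≡.trans (≡.sym v+1+i≡c) (+-suc (toℕ v) i)
    v<c : toℕ v < c
    v<c = ≤-trans (s≤s (m≤m+n (toℕ v) i)) (≤-reflexive (≡.sym c≡))
    v+1<n : suc (toℕ v) < n
    v+1<n = ≤-<-trans v<c c<n
    u = fromℕ< v+1<n
    toℕ-u : toℕ u ≡ suc (toℕ v)
    toℕ-u = toℕ-fromℕ< v+1<n
    u-within : Within i u
    u-within rewrite toℕ-u = ≤-trans v<c (m≤m+n c i) , ≤-reflexive c≡
    v-white : ¬ Blue (Path n) S i v
    v-white v-blue = 1+n≰n (subst (_≤ toℕ v + i) c≡ (proj₂ (Blue⇒Within i v-blue)))
    u~v : Adj (Path n) u v
    u~v = path-adj⁺ (inj₂ (≡.sym toℕ-u))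
    unique : ∀ x → ¬ Blue (Path n) S i x → Adj (Path n) u x →
             WhiteWalk (Path n) (Blue (Path n) S i) v x → x ≡ v
    unique x x-white u~x walk with path-adj⁻ {u = u} {v = x} u~x
    ... | inj₂ x+1≡u = toℕ-injective (ℕ-suc-injective (≡.trans x+1≡u toℕ-u))
    ... | inj₁ u+1≡x = ⊥-elim (x-white (covered (≤-trans (<⇒≤ x<c) (m≤m+n c i) , c≤x+i)))
      where
      x<c : toℕ x < c
      x<c = white-walk-stays-left (covered (source-within i)) walk v<c
      c≤x+i : c ≤ toℕ x + i
      c≤x+i rewrite ≡.sym u+1≡x | toℕ-u = ≤-trans (≤-reflexive c≡) (n≤1+n _)

  Within⇒Blue : ∀ i → Covered i
  Within⇒Blue zero {v} (v≤c+0 , c≤v+0) = subst (_∈ S) (≡.sym (≡source v≡c)) (x∈⁅x⁆ source)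
    where
    v≡c : toℕ v ≡ c
    v≡c = ≤-antisym (subst (toℕ v ≤_) (+-identityʳ c) v≤c+0)
                    (subst (c ≤_) (+-identityʳ (toℕ v)) c≤v+0)
  Within⇒Blue (suc i) {v} (v≤ , c≤) with toℕ v ≤? c + i | c ≤? toℕ v + i
  ... | yes v≤′ | yes c≤′ = inj₁ (Within⇒Blue i (v≤′ , c≤′))
  ... | no v≰ | _ =
    inj₂ (force-rightwards (Within⇒Blue i) (≤-antisym (subst (toℕ v ≤_) (+-suc c i) v≤) (≰⇒> v≰)))
  ... | yes _ | no c≰ =
    inj₂ (force-leftwards (Within⇒Blue i)
            (≤-antisym (subst (_≤ c) (≡.sym (+-suc (toℕ v) i)) (≰⇒> c≰)) c≤))

n≤1+⌊n/2⌋+⌊n/2⌋ : ∀ n → n ≤ suc (⌊ n /2⌋ + ⌊ n /2⌋)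
n≤1+⌊n/2⌋+⌊n/2⌋ zero = z≤n
n≤1+⌊n/2⌋+⌊n/2⌋ (suc zero) = ≤-refl
n≤1+⌊n/2⌋+⌊n/2⌋ (suc (suc n)) =
  s≤s (s≤s (≤-trans (n≤1+⌊n/2⌋+⌊n/2⌋ n) (≤-reflexive (≡.sym (+-suc ⌊ n /2⌋ ⌊ n /2⌋)))))

Path-tight : ∀ m → Σ ℕ λ z → Σ ℕ λ t → IsZplus (Path (suc m)) z × IsThPlusX (Path (suc m)) t ×
                    t ≡ ⌈ (z + suc m) /2⌉
Path-tight m =
  1 , suc c , Z₊≡1 ,
  (1 , Z₊≡1 , (S , c , ≤-reflexive (≡.sym ∣S∣≡1) , (all-blue , fastest) , th≡) , optimal) ,
  refl
  where
  n = suc m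
  c = ⌊ n /2⌋
  open SingleSourceOnPath c (⌊n/2⌋<n m)

  all-blue : AllBlueAt (Path n) S c
  all-blue v = Within⇒Blue c (≤-pred (≤-trans (toℕ<n v) (n≤1+⌊n/2⌋+⌊n/2⌋ n)) , m≤n+m c (toℕ v))

  Z₊≡1 : IsZplus (Path n) 1
  Z₊≡1 = Zplus-singleton (Path n) source (c , all-blue)

  ∣S∣≡1 : ∣ S ∣ ≡ 1
  ∣S∣≡1 = ∣⁅x⁆∣≡1 source

  fastest : ∀ j → AllBlueAt (Path n) S j → c ≤ j
  fastest j all-blue-j = ≤-trans (⌊n/2⌋-mono n≤1+j+j) (≤-reflexive (≡.sym (n≡⌈n+n/2⌉ j)))
    where
    n≤1+j+j : n ≤ suc (j + j)
    n≤1+j+j = subst (n ≤_) (≡.trans (cong (_* suc (j + j)) ∣S∣≡1) (*-identityˡ _))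
                (n≤∣S∣*[1+2pt] (Path n) Path-degree≤2 all-blue-j)

  th≡ : suc c ≡ ∣ S ∣ * suc c
  th≡ = ≡.trans (≡.sym (*-identityˡ (suc c))) (cong (_* suc c) (≡.sym ∣S∣≡1))

  optimal : ∀ S′ k → 1 ≤ ∣ S′ ∣ → IsPT (Path n) S′ k → suc c ≤ ∣ S′ ∣ * suc k
  optimal S′ k 1≤∣S′∣ (all-blue′ , _) = th⁺-lower-bound (Path n) Path-degree≤2 1≤∣S′∣ all-blue′

mainTheorem5 : (∀ (n : ℕ) (G : Graph n) → MaxDegree G 2 →
    ∀ z t → IsZplus G z → IsThPlusX G t → ⌈ (z + n) /2⌉ ≤ t)
    ×
    (∀ (n : ℕ) → 3 ≤ n →
    Σ ℕ λ z → Σ ℕ λ t → IsZplus (Path n) z × IsThPlusX (Path n) t ×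
    t ≡ ⌈ (z + n) /2⌉)
mainTheorem5 = (λ n G Δ≡2 z t → th⁺×-lower-bound G Δ≡2)
             , λ { (suc m) _ → Path-tight m }
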